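{- Let $\Gamma_1,\Gamma_2$ be nonempty finite sets, $\mathcal B_1\subseteq\mathcal P(\Gamma_1)$, $\mathcal B_2=\{B^2_1,\dots,B^2_m\}\subseteq\mathcal P(\Gamma_2)$, and let $\phi\colon\Gamma_1\to\Gamma_2$ be injective. Then for every $A_1\subseteq\Gamma_1$, $$D(\phi(A_1)\mid\mathcal B_2)\;\ge\;D(A_1\mid\mathcal B_1)-D\big(\phi^{ -1}(B^2_1),\dots,\phi^{ -1}(B^2_m)\mid\mathcal B_1\big)\;\ge\;D(A_1\mid\mathcal B_1)-\sum_{B\in\mathcal B_2}D(\phi^{ -1}(B)\mid\mathcal B_1).$$ The same inequalities hold with $D$ replaced throughout by $D_\cap$, and also with $D$ replaced throughout by $D_\cup$.
   Context: Discrete complexity: for a nonempty finite set $\Gamma$ and $\mathcal B\subseteq\mathcal P(\Gamma)$, a sequence $A_1,\dots,A_t$ ($t\ge1$) of subsets of $\Gamma$ generates $A$ from $\mathcal B$ if $A_t=A$ and each $A_i$ equals $X\cup Y$ or $X\cap Y$ for some (not necessarily distinct) $X,Y\in\mathcal B\cup\{A_1,\dots,A_{i-1}\}$. $D(A\mid\mathcal B)$ is the minimum such $t$ ($\infty$ if none). $D_\cap(A\mid\mathcal B)$ (resp. $D_\cup(A\mid\mathcal B)$) is the minimum number of intersection (resp. union) steps in a sequence generating $A$ from $\mathcal B$. For several sets, $D(A_1,\dots,A_s\mid\mathcal B)$ is the minimum length $t$ of a sequence $E_1,\dots,E_t$ in which each $E_j$ is a union or intersection of two sets from $\mathcal B\cup\{E_1,\dots,E_{j-1}\}$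 and every $A_i$ appears in the sequence; $D_\cap(A_1,\dots,A_s\mid\mathcal B)$ and $D_\cup(A_1,\dots,A_s\mid\mathcal B)$ are defined analogously by counting intersections (resp. unions). -}

module Defs where

open import Data.Nat using (ℕ; zero; suc; _≤_)
import Data.Nat as ℕ
open import Data.Bool using (Bool)
open import Data.Fin using (Fin; _≟_)
open import Data.Fin.Properties using (any?)
open import Data.Fin.Subset using (Subset; _∪_; _∩_; _∈_)
open import Data.Fin.Subset.Properties using (_∈?_)
open import Data.Vec using (tabulate; lookup)
open import Data.List using (List; []; _∷_; map; foldr)
open import Data.List.Membership.Propositional using () renaming (_∈_ to _∈ₗ_)
open import Data.List.Relation.Unary.All using (All)
open import Data.Product using (Σ; ∃; _×_; _,_)
open import Data.Sum using (_⊎_)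
open import Data.Unit using (⊤)
open import Data.Empty using (⊥)
open import Relation.Nullary.Decidable using (⌊_⌋; _×-dec_)
open import Relation.Binary.PropositionalEquality using (_≡_)

data ℕ∞ : Set where
  fin : ℕ → ℕ∞
  ∞   : ℕ∞

infixl 6 _+∞_
_+∞_ : ℕ∞ → ℕ∞ → ℕ∞
fin a +∞ fin b = fin (a ℕ.+ b)
fin _ +∞ ∞     = ∞
∞     +∞ _     = ∞

infix 4 _≤∞_
data _≤∞_ : ℕ∞ → ℕ∞ → Set where
  fin≤fin : ∀ {a b} → a ≤ b → fin a ≤∞ fin b
  _≤∞∞    : ∀ x → x ≤∞ ∞

sum∞ : List ℕ∞ → ℕ∞
sum∞ = foldr _+∞_ (fin 0)

image : ∀ {n₁ n₂} → (Fin n₁ → Fin n₂) → Subset n₁ → Subset n₂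
image φ A = tabulate λ y → ⌊ any? (λ x → (x ∈? A) ×-dec (φ x ≟ y)) ⌋

preimage : ∀ {n₁ n₂} → (Fin n₁ → Fin n₂) → Subset n₂ → Subset n₁
preimage φ B = tabulate λ x → lookup B (φ x)

-- Generating sequences.  A sequence E₁,…,E_t is a list of steps; each
-- step records the operation used and its two operands X, Y.

data Op : Set where
  ∪op ∩op : Op

record Step (n : ℕ) : Set where
  constructor step
  field
    op : Op
    left right : Subset n

result : ∀ {n} → Step n → Subset n
result (step ∪op X Y) = X ∪ Y
result (step ∩op X Y) = X ∩ Y

Valid : ∀ {n} → List (Subset n) → List (Step n) → Set
Valid avail []       = ⊤
Valid avail (s ∷ ss) =
  (Step.left s ∈ₗ avail) × (Step.right s ∈ₗ avail) × Valid (result s ∷ avail) ss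

outputs : ∀ {n} → List (Step n) → List (Subset n)
outputs = map result

lastOut : ∀ {n} → List (Step n) → Subset n → Set
lastOut []           A = ⊥
lastOut (s ∷ [])     A = result s ≡ A
lastOut (_ ∷ t ∷ ss) A = lastOut (t ∷ ss) A

Generates : ∀ {n} → List (Subset n) → Subset n → List (Step n) → Set
Generates 𝓑 A seq = Valid 𝓑 seq × lastOut seq A

GeneratesAll : ∀ {n} → List (Subset n) → List (Subset n) → List (Step n) → Set
GeneratesAll 𝓑 As seq = Valid 𝓑 seq × All (λ A → A ∈ₗ outputs seq) As

data Kind : Set where
  D-len D-∩ D-∪ : Kind

countOp : ∀ {n} → Op → List (Step n) → ℕ
countOp o [] = 0
countOp ∪op (step ∪op _ _ ∷ ss) = suc (countOp ∪op ss)
countOp ∪op (step ∩op _ _ ∷ ss) = countOp ∪op ss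
countOp ∩op (step ∩op _ _ ∷ ss) = suc (countOp ∩op ss)
countOp ∩op (step ∪op _ _ ∷ ss) = countOp ∩op ss

cost : ∀ {n} → Kind → List (Step n) → ℕ
cost D-len seq = Data.List.length seq
cost D-∩   seq = countOp ∩op seq
cost D-∪   seq = countOp ∪op seq

-- d is the minimum of  cost κ  over sequences satisfying P
-- (d = ∞ iff there is no such sequence).
IsMin : ∀ {n} → Kind → (List (Step n) → Set) → ℕ∞ → Set
IsMin κ P d =
  (∀ seq → P seq → d ≤∞ fin (cost κ seq)) ×
  (d ≡ ∞ ⊎ ∃ λ seq → P seq × fin (cost κ seq) ≡ d)

IsD : ∀ {n} → Kind → List (Subset n) → Subset n → ℕ∞ → Set
IsD κ 𝓑 A d = IsMin κ (Generates 𝓑 A) d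

IsDAll : ∀ {n} → Kind → List (Subset n) → List (Subset n) → ℕ∞ → Set
IsDAll κ 𝓑 As d = IsMin κ (GeneratesAll 𝓑 As) d

{-# OPTIONS --safe #-}
-- Preimage under φ commutes with ∪ and ∩, so running a sequence that
-- generates φ(A) from 𝓑₂ through φ⁻¹ gives a sequence of the same shape
-- generating φ⁻¹(φ(A)) = A (φ injective) from the sets φ⁻¹(B), B ∈ 𝓑₂.
-- Prefixing a sequence that produces all of these from 𝓑₁ yields the first
-- inequality; concatenating optimal sequences for the single φ⁻¹(B) yields
-- the second.
module Submission where

open import Defs
open import Data.Nat using (ℕ; zero; suc; _<_; _+_)
open import Data.Nat.Properties using (+-comm)
open import Data.Bool using (Bool; true; false)
open import Data.Fin using (Fin)
import Data.Fin as Fin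
open import Data.Fin.Subset using (Subset; _∪_; _∩_)
import Data.Fin.Subset as Subset
open import Data.Vec using (tabulate; lookup; zipWith)
import Data.Vec as Vec
open import Data.Vec.Properties
  using (lookup∘tabulate; tabulate∘lookup; tabulate-cong; lookup-zipWith; []=⇒lookup; lookup⇒[]=)
open import Data.List using (List; []; _∷_; _++_; map)
open import Data.List.Properties using (map-++; length-++; length-map)
open import Data.List.Membership.Propositional using (_∈_)
open import Data.List.Membership.Propositional.Properties using (∈-map⁺)
open import Data.List.Relation.Unary.Any using (here; there)
open import Data.List.Relation.Unary.All using (All; []; _∷_)
import Data.List.Relation.Unary.All as All
open import Data.List.Relation.Unary.Unique.Propositional using (Unique)
open import Data.List.Relation.Binary.Subset.Propositional using (_⊆_)
open import Data.List.Relation.Binary.Subset.Propositional.Properties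
  using (⊆-trans; ⊆-reflexive; ∷⁺ʳ; xs⊆xs++ys; xs⊆ys++xs)
open import Data.Product using (_×_; ∃; _,_; proj₂)
open import Data.Sum using (_⊎_; inj₁; inj₂)
open import Data.Unit using (tt)
open import Data.Empty using (⊥-elim)
open import Relation.Nullary using (Dec; yes; no)
open import Relation.Nullary.Decidable using (⌊_⌋)
open import Function using (_∘_)
open import Relation.Binary.PropositionalEquality
  using (_≡_; refl; sym; trans; cong; subst; module ≡-Reasoning)
open import Function.Definitions using (Injective)

private
  variable
    n m : ℕ

zipWith-tabulate : {A B C : Set} (f : A → B → C) (g : Fin n → A) (h : Fin n → B) →
                   zipWith f (tabulate g) (tabulate h) ≡ tabulate (λ i → f (g i) (h i))
zipWith-tabulate {n = zero}  f g h = refl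
zipWith-tabulate {n = suc n} f g h =
  cong (f (g Fin.zero) (h Fin.zero) Vec.∷_) (zipWith-tabulate f (g ∘ Fin.suc) (h ∘ Fin.suc))

module _ (φ : Fin n → Fin m) where

  preimage-zipWith : (_·_ : Bool → Bool → Bool) (X Y : Subset m) →
                     preimage φ (zipWith _·_ X Y) ≡ zipWith _·_ (preimage φ X) (preimage φ Y)
  preimage-zipWith _·_ X Y = trans
    (tabulate-cong λ x → lookup-zipWith _·_ (φ x) X Y)
    (sym (zipWith-tabulate _·_ (lookup X ∘ φ) (lookup Y ∘ φ)))

  preimage-∪ : (X Y : Subset m) → preimage φ (X ∪ Y) ≡ preimage φ X ∪ preimage φ Y
  preimage-∪ = preimage-zipWith _

  preimage-∩ : (X Y : Subset m) → preimage φ (X ∩ Y) ≡ preimage φ X ∩ preimage φ Y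
  preimage-∩ = preimage-zipWith _

  module _ (φ-inj : Injective _≡_ _≡_ φ) where

    lookup-image : (A : Subset n) (x : Fin n) → lookup (image φ A) (φ x) ≡ lookup A x
    lookup-image A x = trans (lookup∘tabulate _ (φ x)) (decided _)
      where
      decided : (d : Dec (∃ λ x′ → x′ Subset.∈ A × φ x′ ≡ φ x)) → ⌊ d ⌋ ≡ lookup A x
      decided (yes (x′ , x′∈A , φx′≡φx)) with φ-inj φx′≡φx
      ... | refl = sym ([]=⇒lookup x′∈A)
      decided (no ∄x′) with lookup A x in Ax
      ... | true  = ⊥-elim (∄x′ (x , lookup⇒[]= x A Ax , refl))
      ... | false = refl

    preimage-image : (A : Subset n) → preimage φ (image φ A) ≡ A
    preimage-image A = trans (tabulate-cong (lookup-image A)) (tabulate∘lookup A)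

available : List (Subset n) → List (Step n) → List (Subset n)
available avail []       = avail
available avail (s ∷ ss) = available (result s ∷ avail) ss

initial⊆available : ∀ {avail : List (Subset n)} ss → avail ⊆ available avail ss
initial⊆available []       = λ X∈ → X∈
initial⊆available (s ∷ ss) = initial⊆available ss ∘ there

outputs⊆available : ∀ {avail : List (Subset n)} ss → outputs ss ⊆ available avail ss
outputs⊆available (s ∷ ss) (here refl) = initial⊆available ss (here refl)
outputs⊆available (s ∷ ss) (there X∈) = outputs⊆available ss X∈

outputs-++⁺ˡ : (xs ys : List (Step n)) → outputs xs ⊆ outputs (xs ++ ys)
outputs-++⁺ˡ xs ys = ⊆-trans (xs⊆xs++ys _ _) (⊆-reflexive (sym (map-++ result xs ys)))

outputs-++⁺ʳ : (xs ys : List (Step n)) → outputs ys ⊆ outputs (xs ++ ys)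
outputs-++⁺ʳ xs ys = ⊆-trans (xs⊆ys++xs _ _) (⊆-reflexive (sym (map-++ result xs ys)))

Valid-mono : ∀ {avail avail′ : List (Subset n)} ss → avail ⊆ avail′ → Valid avail ss → Valid avail′ ss
Valid-mono []       _   _             = tt
Valid-mono (s ∷ ss) sub (l , r , val) = sub l , sub r , Valid-mono ss (∷⁺ʳ (result s) sub) val

Valid-++ : ∀ {avail : List (Subset n)} xs {ys} →
           Valid avail xs → Valid (available avail xs) ys → Valid avail (xs ++ ys)
Valid-++ []       _             val′ = val′
Valid-++ (s ∷ xs) (l , r , val) val′ = l , r , Valid-++ xs val val′

lastOut⇒∈outputs : ∀ ss {A : Subset n} → lastOut ss A → A ∈ outputs ss
lastOut⇒∈outputs (s ∷ [])     s≡A  = here (sym s≡A)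
lastOut⇒∈outputs (s ∷ t ∷ ss) last = there (lastOut⇒∈outputs (t ∷ ss) last)

lastOut-++ : ∀ xs ys {A : Subset n} → lastOut ys A → lastOut (xs ++ ys) A
lastOut-++ []           ys       last = last
lastOut-++ (x ∷ [])     (y ∷ ys) last = last
lastOut-++ (x ∷ x′ ∷ xs) ys      last = lastOut-++ (x′ ∷ xs) ys last

Generates-++ : ∀ {𝓑 : List (Subset n)} {A} P {S} →
               Valid 𝓑 P → Generates (available 𝓑 P) A S → Generates 𝓑 A (P ++ S)
Generates-++ P val (val′ , last) = Valid-++ P val val′ , lastOut-++ P _ last

GeneratesAll-∷ : ∀ {𝓑 : List (Subset n)} {A As} S {T} →
                 Generates 𝓑 A S → GeneratesAll 𝓑 As T → GeneratesAll 𝓑 (A ∷ As) (S ++ T)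
GeneratesAll-∷ S {T} (valS , last) (valT , allT) =
  Valid-++ S valS (Valid-mono T (initial⊆available S) valT) ,
  outputs-++⁺ˡ S T (lastOut⇒∈outputs S last) ∷ All.map (outputs-++⁺ʳ S T) allT

mapStep : (Subset n → Subset m) → Step n → Step m
mapStep f (step o X Y) = step o (f X) (f Y)

countOp-++ : ∀ o (xs ys : List (Step n)) → countOp o (xs ++ ys) ≡ countOp o xs + countOp o ys
countOp-++ o   []                  ys = refl
countOp-++ ∪op (step ∪op _ _ ∷ xs) ys = cong suc (countOp-++ ∪op xs ys)
countOp-++ ∪op (step ∩op _ _ ∷ xs) ys = countOp-++ ∪op xs ys
countOp-++ ∩op (step ∩op _ _ ∷ xs) ys = cong suc (countOp-++ ∩op xs ys)
countOp-++ ∩op (step ∪op _ _ ∷ xs) ys = countOp-++ ∩op xs ys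

countOp-map : ∀ (f : Subset n → Subset m) o ss → countOp o (map (mapStep f) ss) ≡ countOp o ss
countOp-map f o   []                  = refl
countOp-map f ∪op (step ∪op _ _ ∷ ss) = cong suc (countOp-map f ∪op ss)
countOp-map f ∪op (step ∩op _ _ ∷ ss) = countOp-map f ∪op ss
countOp-map f ∩op (step ∩op _ _ ∷ ss) = cong suc (countOp-map f ∩op ss)
countOp-map f ∩op (step ∪op _ _ ∷ ss) = countOp-map f ∩op ss

cost-[] : ∀ κ → cost {n} κ [] ≡ 0
cost-[] D-len = refl
cost-[] D-∩   = refl
cost-[] D-∪   = refl

cost-++ : ∀ κ (xs ys : List (Step n)) → cost κ (xs ++ ys) ≡ cost κ xs + cost κ ys
cost-++ D-len xs ys = length-++ xs
cost-++ D-∩   xs ys = countOp-++ ∩op xs ys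
cost-++ D-∪   xs ys = countOp-++ ∪op xs ys

cost-map : ∀ κ (f : Subset n → Subset m) ss → cost κ (map (mapStep f) ss) ≡ cost κ ss
cost-map D-len f ss = length-map (mapStep f) ss
cost-map D-∩   f ss = countOp-map f ∩op ss
cost-map D-∪   f ss = countOp-map f ∪op ss

module LatticeHomomorphism
  (f : Subset n → Subset m)
  (f-∪ : ∀ X Y → f (X ∪ Y) ≡ f X ∪ f Y)
  (f-∩ : ∀ X Y → f (X ∩ Y) ≡ f X ∩ f Y)
  where

  result-mapStep : ∀ s → f (result s) ≡ result (mapStep f s)
  result-mapStep (step ∪op X Y) = f-∪ X Y
  result-mapStep (step ∩op X Y) = f-∩ X Y

  Valid-map : ∀ {avail avail′} ss → (∀ {X} → X ∈ avail → f X ∈ avail′) →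
              Valid avail ss → Valid avail′ (map (mapStep f) ss)
  Valid-map []       _  _             = tt
  Valid-map (s ∷ ss) f∈ (l , r , val) = f∈ l , f∈ r , Valid-map ss f∈′ val
    where
    f∈′ : ∀ {X} → X ∈ result s ∷ _ → f X ∈ result (mapStep f s) ∷ _
    f∈′ (here refl) = here (result-mapStep s)
    f∈′ (there X∈)  = there (f∈ X∈)

  lastOut-map : ∀ ss {A} → lastOut ss A → lastOut (map (mapStep f) ss) (f A)
  lastOut-map (s ∷ [])     refl = sym (result-mapStep s)
  lastOut-map (s ∷ t ∷ ss) last = lastOut-map (t ∷ ss) last

  Generates-map : ∀ {𝓑 𝓒 A} S → (∀ {X} → X ∈ 𝓑 → f X ∈ 𝓒) →
                  Generates 𝓑 A S → Generates 𝓒 (f A) (map (mapStep f) S)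
  Generates-map S f∈ (val , last) = Valid-map S f∈ val , lastOut-map S last

module _ (κ : Kind) where

  LowerBound : (List (Step n) → Set) → ℕ∞ → Set
  LowerBound P d = ∀ seq → P seq → d ≤∞ fin (cost κ seq)

  Realised : (List (Step n) → Set) → ℕ∞ → Set
  Realised P d = d ≡ ∞ ⊎ ∃ λ seq → P seq × fin (cost κ seq) ≡ d

  LowerBound-≤-Realised : ∀ {P : List (Step n) → Set} {c d} →
                          LowerBound P c → Realised P d → c ≤∞ d
  LowerBound-≤-Realised lb (inj₁ refl)             = _ ≤∞∞
  LowerBound-≤-Realised lb (inj₂ (seq , p , refl)) = lb seq p

  Realised-+ : ∀ {n₁ n₂ n₃} {P : List (Step n₁) → Set} {Q : List (Step n₂) → Set}
                 {R : List (Step n₃) → Set} {a b} →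
               (∀ {p q} → P p → Q q → ∃ λ r → R r × cost κ r ≡ cost κ p + cost κ q) →
               Realised P a → Realised Q b → Realised R (a +∞ b)
  Realised-+ combine (inj₁ refl)            _                     = inj₁ refl
  Realised-+ combine (inj₂ (_ , _ , refl)) (inj₁ refl)            = inj₁ refl
  Realised-+ combine (inj₂ (_ , p , refl)) (inj₂ (_ , q , refl)) with combine p q
  ... | r , rR , cost-r = inj₂ (r , rR , cong fin cost-r)

  Realised-GeneratesAll : ∀ {X : Set} {𝓑 : List (Subset n)} (f : X → Subset n) (d : X → ℕ∞) xs →
                          (∀ x → x ∈ xs → Realised (Generates 𝓑 (f x)) (d x)) →
                          Realised (GeneratesAll 𝓑 (map f xs)) (sum∞ (map d xs))
  Realised-GeneratesAll f d []       _    = inj₂ ([] , (tt , []) , cong fin (cost-[] κ))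
  Realised-GeneratesAll f d (x ∷ xs) real =
    Realised-+ (λ {S} {T} gen genAll → S ++ T , GeneratesAll-∷ S gen genAll , cost-++ κ S T)
               (real x (here refl))
               (Realised-GeneratesAll f d xs (λ x′ x′∈ → real x′ (there x′∈)))

Generates-pullback : ∀ κ {𝓑₁ : List (Subset n)} {𝓑₂ : List (Subset m)} {φ : Fin n → Fin m} →
                     Injective _≡_ _≡_ φ → ∀ {A S P} →
                     Generates 𝓑₂ (image φ A) S → GeneratesAll 𝓑₁ (map (preimage φ) 𝓑₂) P →
                     ∃ λ r → Generates 𝓑₁ A r × cost κ r ≡ cost κ S + cost κ P
Generates-pullback κ {𝓑₁} {𝓑₂} {φ} φ-inj {A} {S} {P} genS (valP , allP) =
  P ++ S′ , Generates-++ P valP genS′ , cost-P++S′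
  where
  open LatticeHomomorphism (preimage φ) (preimage-∪ φ) (preimage-∩ φ)
  S′ = map (mapStep (preimage φ)) S

  genS′ : Generates (available 𝓑₁ P) A S′
  genS′ = subst (λ X → Generates _ X S′) (preimage-image φ φ-inj A)
    (Generates-map S (λ B∈ → outputs⊆available P (All.lookup allP (∈-map⁺ (preimage φ) B∈))) genS)

  cost-P++S′ : cost κ (P ++ S′) ≡ cost κ S + cost κ P
  cost-P++S′ = begin
    cost κ (P ++ S′)       ≡⟨ cost-++ κ P S′ ⟩
    cost κ P + cost κ S′   ≡⟨ cong (cost κ P +_) (cost-map κ (preimage φ) S) ⟩
    cost κ P + cost κ S    ≡⟨ +-comm (cost κ P) (cost κ S) ⟩
    cost κ S + cost κ P    ∎
    where open ≡-Reasoning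

lemma2p9 : (κ : Kind) {n₁ n₂ : ℕ} → 0 < n₁ → 0 < n₂ →
           (𝓑₁ : List (Subset n₁)) (𝓑₂ : List (Subset n₂)) → Unique 𝓑₂ →
           (φ : Fin n₁ → Fin n₂) → Injective _≡_ _≡_ φ →
           (A₁ : Subset n₁) →
           (dA dφA dPre : ℕ∞) (dB : Subset n₂ → ℕ∞) →
           IsD κ 𝓑₂ (image φ A₁) dφA →
           IsD κ 𝓑₁ A₁ dA →
           IsDAll κ 𝓑₁ (map (preimage φ) 𝓑₂) dPre →
           (∀ B → B ∈ 𝓑₂ → IsD κ 𝓑₁ (preimage φ B) (dB B)) →
           (dA ≤∞ dφA +∞ dPre) × (dPre ≤∞ sum∞ (map dB 𝓑₂))
lemma2p9 κ _ _ 𝓑₁ 𝓑₂ _ φ φ-inj A₁ dA dφA dPre dB (_ , realφA) (lbA , _) (lbPre , realPre) isDB =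
  LowerBound-≤-Realised κ lbA
    (Realised-+ κ (Generates-pullback κ φ-inj) realφA realPre) ,
  LowerBound-≤-Realised κ lbPre
    (Realised-GeneratesAll κ (preimage φ) dB 𝓑₂ (λ B B∈ → proj₂ (isDB B B∈)))
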